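{- Let $a=(a_1,\dots,a_m)$ be a one-row descending plane partition of order $n$ with no special part, and let $\pi=\beta\gamma$ be the permutation of $\{1,\dots,n\}$ associated to it, where $\gamma=(a_1,a_2-1,\dots,a_m-(m-1))$ and $\beta$ is the complement $\{1,\dots,n\}\setminus\{\gamma_1,\dots,\gamma_m\}$ in decreasing order. Then the non-inversion number of $\pi$ is $I(\pi)=\sum_{i=1}^m a_i-m^2$.
   Context: A one-row descending plane partition of order $n$ is a sequence $(a_1,\dots,a_m)$ of positive integers with $n\ge a_1\ge\dots\ge a_m$ and $a_1>m$; it has no special part if $a_j\ge j$ for all $j$. The non-inversion number $I(\pi)$ of a permutation $\pi$ of $\{1,\dots,n\}$ is the number of pairs $i<j$ with $\pi_i<\pi_j$. -}

module Defs where

open import Data.Nat using (ℕ; zero; suc; _+_; _*_; _∸_; _≤_; _<_; _≥_; _>_; _<ᵇ_)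
open import Data.List using (List; []; _∷_; length; filter; _++_; downFrom; map)
open import Data.List.Relation.Unary.Any using (any?)
open import Data.List.Relation.Unary.All using (All)
open import Data.Nat.Properties using (_≟_)
open import Relation.Nullary using (¬_)
open import Relation.Nullary.Decidable using (¬?)
open import Relation.Binary.PropositionalEquality using (_≡_)
open import Data.Product using (_×_)
open import Data.Unit using (⊤)
open import Data.Bool using (true; false; if_then_else_)

data Decreasing : List ℕ → Set where
  []  : Decreasing []
  [_] : ∀ x → Decreasing (x ∷ [])
  _∷_ : ∀ {x y xs} → x ≥ y → Decreasing (y ∷ xs) → Decreasing (x ∷ y ∷ xs)

data OneRowDPP (n : ℕ) : List ℕ → Set where
  dpp : ∀ a₁ as → n ≥ a₁ → Decreasing (a₁ ∷ as) → All (λ x → x ≥ 1) (a₁ ∷ as)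
      → a₁ > length (a₁ ∷ as) → OneRowDPP n (a₁ ∷ as)

NoSpecialFrom : ℕ → List ℕ → Set
NoSpecialFrom k []       = ⊤
NoSpecialFrom k (x ∷ xs) = (x ≥ k) × NoSpecialFrom (suc k) xs

NoSpecialPart : List ℕ → Set
NoSpecialPart = NoSpecialFrom 1

gammaFrom : ℕ → List ℕ → List ℕ
gammaFrom k []       = []
gammaFrom k (x ∷ xs) = (x ∸ k) ∷ gammaFrom (suc k) xs

gamma : List ℕ → List ℕ
gamma = gammaFrom 0

-- β = {1..n} \ γ in decreasing order (downFrom n = n-1,...,0, so shift by 1)
beta : ℕ → List ℕ → List ℕ
beta n a = filter (λ x → ¬? (any? (x ≟_) (gamma a))) (map suc (downFrom n))

perm : ℕ → List ℕ → List ℕ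
perm n a = beta n a ++ gamma a

countGreater : ℕ → List ℕ → ℕ
countGreater x []       = 0
countGreater x (y ∷ ys) = (if x <ᵇ y then 1 else 0) + countGreater x ys

nonInv : List ℕ → ℕ
nonInv []       = 0
nonInv (x ∷ xs) = countGreater x xs + nonInv xs

-- Since β and γ are both decreasing, the non-inversions of π = βγ are exactly the
-- pairs (b, c) with b in β, c in γ and b < c.  The entries of γ are distinct, and an
-- entry c of γ with j entries of γ below it has c − 1 − j entries of β below it, so
-- I(π) = Σ γᵢ − (1 + 2 + ⋯ + m).  Since a has no special part, Σ γᵢ = Σ aᵢ − (0 + 1 + ⋯ + (m − 1)),
-- and the two triangular numbers add up to m².  The first identity is proved for any
-- subset of {1, …, n} by induction on n, according to whether n belongs to the subset.
module Submission where

open import Defs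
open import Data.Nat using (ℕ; zero; suc; _+_; _*_; _∸_; _≤_; _<_; _≤′_; ≤′-refl; ≤′-step; _<ᵇ_; z≤n; s≤s)
open import Data.Nat.Properties
open import Data.Nat.ListAction using (sum)
open import Data.Nat.Solver using (module +-*-Solver)
open import Data.List using (List; []; _∷_; _++_; length; filter; map; downFrom)
open import Data.List.Properties using (filter-accept; filter-reject)
open import Data.List.Membership.Propositional using (_∈_; _∉_)
open import Data.List.Membership.DecPropositional _≟_ using (_∈?_; _∉?_)
open import Data.List.Relation.Unary.All as All using (All; []; _∷_)
open import Data.List.Relation.Unary.All.Properties using (++⁺; filter⁺; All¬⇒¬Any)
open import Data.List.Relation.Unary.Any using (here; there)
open import Data.Bool using (true; false; if_then_else_)
open import Data.Product using (_,_)
open import Data.Unit using (tt)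
open import Relation.Nullary using (Dec; yes; no; contradiction)
open import Relation.Binary.PropositionalEquality
  using (_≡_; _≢_; refl; sym; trans; cong; cong₂; subst; module ≡-Reasoning)

open +-*-Solver using (solve; _:=_; _:+_; _:*_; con)
open ≡-Reasoning

rangeSum : ℕ → ℕ → ℕ
rangeSum k zero    = 0
rangeSum k (suc l) = k + rangeSum (suc k) l

rangeSum-suc : ∀ k l → rangeSum k (suc l) ≡ rangeSum k l + (k + l)
rangeSum-suc k zero    = trans (+-identityʳ k) (sym (+-identityʳ k))
rangeSum-suc k (suc l) = begin
  k + rangeSum (suc k) (suc l)
    ≡⟨ cong (k +_) (rangeSum-suc (suc k) l) ⟩
  k + (rangeSum (suc k) l + (suc k + l))
    ≡⟨ solve 3 (λ k r l → k :+ (r :+ (con 1 :+ k :+ l)) := k :+ r :+ (k :+ (con 1 :+ l))) refl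
         k (rangeSum (suc k) l) l ⟩
  k + rangeSum (suc k) l + (k + suc l) ∎

rangeSum-1+rangeSum-0 : ∀ m → rangeSum 1 m + rangeSum 0 m ≡ m * m
rangeSum-1+rangeSum-0 zero    = refl
rangeSum-1+rangeSum-0 (suc m) = begin
  rangeSum 1 (suc m) + rangeSum 0 (suc m)
    ≡⟨ cong₂ _+_ (rangeSum-suc 1 m) (rangeSum-suc 0 m) ⟩
  rangeSum 1 m + suc m + (rangeSum 0 m + m)
    ≡⟨ solve 3 (λ r s m → r :+ (con 1 :+ m) :+ (s :+ m) := r :+ s :+ (con 1 :+ m :+ m)) refl
         (rangeSum 1 m) (rangeSum 0 m) m ⟩
  rangeSum 1 m + rangeSum 0 m + (suc m + m)
    ≡⟨ cong (_+ (suc m + m)) (rangeSum-1+rangeSum-0 m) ⟩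
  m * m + (suc m + m)
    ≡⟨ solve 1 (λ m → m :* m :+ (con 1 :+ m :+ m) := (con 1 :+ m) :* (con 1 :+ m)) refl m ⟩
  suc m * suc m ∎

countGreater-≤ : ∀ {x} ys → All (_≤ x) ys → countGreater x ys ≡ 0
countGreater-≤ []       []           = refl
countGreater-≤ {x} (y ∷ ys) (y≤x ∷ ys≤x) with x <ᵇ y | <ᵇ⇒< x y
... | true  | x<y = contradiction (x<y tt) (≤⇒≯ y≤x)
... | false | _   = countGreater-≤ ys ys≤x

countGreater-insert : ∀ {x y} xs ys → x < y →
  countGreater x (xs ++ y ∷ ys) ≡ suc (countGreater x (xs ++ ys))
countGreater-insert {x} {y} [] ys x<y with x <ᵇ y | <⇒<ᵇ x<y
... | true | _ = refl
countGreater-insert {x} (z ∷ xs) ys x<y rewrite countGreater-insert xs ys x<y =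
  +-suc (if x <ᵇ z then 1 else 0) (countGreater x (xs ++ ys))

nonInv-cons-≤ : ∀ {x} xs → All (_≤ x) xs → nonInv (x ∷ xs) ≡ nonInv xs
nonInv-cons-≤ xs xs≤x = cong (_+ nonInv xs) (countGreater-≤ xs xs≤x)

nonInv-insert : ∀ {y} xs ys → All (_< y) xs → All (_≤ y) ys →
  nonInv (xs ++ y ∷ ys) ≡ length xs + nonInv (xs ++ ys)
nonInv-insert []       ys []           ys≤y = nonInv-cons-≤ ys ys≤y
nonInv-insert {y} (x ∷ xs) ys (x<y ∷ xs<y) ys≤y = begin
  countGreater x (xs ++ y ∷ ys) + nonInv (xs ++ y ∷ ys)
    ≡⟨ cong₂ _+_ (countGreater-insert xs ys x<y) (nonInv-insert xs ys xs<y ys≤y) ⟩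
  suc (countGreater x (xs ++ ys)) + (length xs + nonInv (xs ++ ys))
    ≡⟨ solve 3 (λ c l n → con 1 :+ c :+ (l :+ n) := con 1 :+ l :+ (c :+ n)) refl
         (countGreater x (xs ++ ys)) (length xs) (nonInv (xs ++ ys)) ⟩
  suc (length xs) + nonInv (x ∷ xs ++ ys) ∎

data DescSubset : ℕ → List ℕ → Set where
  []   : DescSubset 0 []
  skip : ∀ {n g} → DescSubset n g → DescSubset (suc n) g
  take : ∀ {n g} → DescSubset n g → DescSubset (suc n) (suc n ∷ g)

DescSubset-≤ : ∀ {n g} → DescSubset n g → All (_≤ n) g
DescSubset-≤ []       = []
DescSubset-≤ (skip d) = All.map m≤n⇒m≤1+n (DescSubset-≤ d)
DescSubset-≤ (take d) = ≤-refl ∷ All.map m≤n⇒m≤1+n (DescSubset-≤ d)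

DescSubset-weaken : ∀ {m n g} → m ≤′ n → DescSubset m g → DescSubset n g
DescSubset-weaken ≤′-refl       d = d
DescSubset-weaken (≤′-step m≤n) d = skip (DescSubset-weaken m≤n d)

complement : ℕ → List ℕ → List ℕ
complement n g = filter (_∉? g) (map suc (downFrom n))

map-suc-downFrom-≤ : ∀ n → All (_≤ n) (map suc (downFrom n))
map-suc-downFrom-≤ zero    = []
map-suc-downFrom-≤ (suc n) = ≤-refl ∷ All.map m≤n⇒m≤1+n (map-suc-downFrom-≤ n)

complement-≤ : ∀ n g → All (_≤ n) (complement n g)
complement-≤ n g = filter⁺ (_∉? g) (map-suc-downFrom-≤ n)

≤⇒1+≢ : ∀ {n xs} → All (_≤ n) xs → All (suc n ≢_) xs
≤⇒1+≢ = All.map (λ x≤n → >⇒≢ (s≤s x≤n))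

filter-∉-∷ : ∀ {y g} xs → All (y ≢_) xs → filter (_∉? y ∷ g) xs ≡ filter (_∉? g) xs
filter-∉-∷         []       []           = refl
filter-∉-∷ {y} {g} (x ∷ xs) (y≢x ∷ xs≢y) = by-cases (x ∈? g)
  where
  by-cases : Dec (x ∈ g) → filter (_∉? y ∷ g) (x ∷ xs) ≡ filter (_∉? g) (x ∷ xs)
  by-cases (yes x∈g) = begin
    filter (_∉? y ∷ g) (x ∷ xs) ≡⟨ filter-reject (_∉? y ∷ g) (λ x∉ → x∉ (there x∈g)) ⟩
    filter (_∉? y ∷ g) xs       ≡⟨ filter-∉-∷ xs xs≢y ⟩
    filter (_∉? g) xs           ≡⟨ filter-reject (_∉? g) (λ x∉ → x∉ x∈g) ⟨
    filter (_∉? g) (x ∷ xs)     ∎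
  by-cases (no x∉g) = begin
    filter (_∉? y ∷ g) (x ∷ xs) ≡⟨ filter-accept (_∉? y ∷ g) x∉y∷g ⟩
    x ∷ filter (_∉? y ∷ g) xs   ≡⟨ cong (x ∷_) (filter-∉-∷ xs xs≢y) ⟩
    x ∷ filter (_∉? g) xs       ≡⟨ filter-accept (_∉? g) x∉g ⟨
    filter (_∉? g) (x ∷ xs)     ∎
    where
    x∉y∷g : x ∉ y ∷ g
    x∉y∷g (here x≡y)  = y≢x (sym x≡y)
    x∉y∷g (there x∈g) = x∉g x∈g

complement-∉ : ∀ {n g} → suc n ∉ g → complement (suc n) g ≡ suc n ∷ complement n g
complement-∉ {g = g} = filter-accept (_∉? g)

complement-∷ : ∀ n g → complement (suc n) (suc n ∷ g) ≡ complement n g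
complement-∷ n g = begin
  filter (_∉? suc n ∷ g) (suc n ∷ map suc (downFrom n)) ≡⟨ filter-reject (_∉? suc n ∷ g) (λ n∉ → n∉ (here refl)) ⟩
  filter (_∉? suc n ∷ g) (map suc (downFrom n))         ≡⟨ filter-∉-∷ _ (≤⇒1+≢ (map-suc-downFrom-≤ n)) ⟩
  complement n g                                         ∎

length-complement : ∀ {n g} → DescSubset n g → length (complement n g) + length g ≡ n
length-complement []       = refl
length-complement (skip {n} {g} d)
  rewrite complement-∉ {n} {g} (All¬⇒¬Any (≤⇒1+≢ (DescSubset-≤ d))) = cong suc (length-complement d)
length-complement (take {n} {g} d) rewrite complement-∷ n g =
  trans (+-suc (length (complement n g)) (length g)) (cong suc (length-complement d))

nonInv-complement : ∀ {n g} → DescSubset n g →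
  nonInv (complement n g ++ g) + rangeSum 1 (length g) ≡ sum g
nonInv-complement []       = refl
nonInv-complement (skip {n} {g} d)
  rewrite complement-∉ {n} {g} (All¬⇒¬Any (≤⇒1+≢ (DescSubset-≤ d)))
        | nonInv-cons-≤ (complement n g ++ g)
            (All.map m≤n⇒m≤1+n (++⁺ (complement-≤ n g) (DescSubset-≤ d)))
        = nonInv-complement d
nonInv-complement (take {n} {g} d) = begin
  nonInv (complement (suc n) (suc n ∷ g) ++ suc n ∷ g) + rangeSum 1 (suc l)
    ≡⟨ cong (λ c → nonInv (c ++ suc n ∷ g) + rangeSum 1 (suc l)) (complement-∷ n g) ⟩
  nonInv (c ++ suc n ∷ g) + rangeSum 1 (suc l)
    ≡⟨ cong₂ _+_ (nonInv-insert c g c<1+n g≤1+n) (rangeSum-suc 1 l) ⟩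
  length c + nonInv (c ++ g) + (rangeSum 1 l + suc l)
    ≡⟨ solve 4 (λ k i r l → k :+ i :+ (r :+ (con 1 :+ l)) := con 1 :+ (k :+ l) :+ (i :+ r)) refl
         (length c) (nonInv (c ++ g)) (rangeSum 1 l) l ⟩
  suc (length c + l) + (nonInv (c ++ g) + rangeSum 1 l)
    ≡⟨ cong₂ (λ k s → suc k + s) (length-complement d) (nonInv-complement d) ⟩
  suc n + sum g ∎
  where
  c : List ℕ
  c = complement n g
  l : ℕ
  l = length g
  c<1+n : All (_< suc n) c
  c<1+n = All.map s≤s (complement-≤ n g)
  g≤1+n : All (_≤ suc n) g
  g≤1+n = All.map m≤n⇒m≤1+n (DescSubset-≤ d)

length-gammaFrom : ∀ k xs → length (gammaFrom k xs) ≡ length xs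
length-gammaFrom k []       = refl
length-gammaFrom k (x ∷ xs) = cong suc (length-gammaFrom (suc k) xs)

NoSpecialFrom-weaken : ∀ {k} xs → NoSpecialFrom (suc k) xs → NoSpecialFrom k xs
NoSpecialFrom-weaken []       _           = tt
NoSpecialFrom-weaken (x ∷ xs) (k<x , ns) = <⇒≤ k<x , NoSpecialFrom-weaken xs ns

sum-gammaFrom : ∀ {k} xs → NoSpecialFrom k xs →
  sum (gammaFrom k xs) + rangeSum k (length xs) ≡ sum xs
sum-gammaFrom         []       _          = refl
sum-gammaFrom {k} (x ∷ xs) (k≤x , ns) = begin
  x ∸ k + sum (gammaFrom (suc k) xs) + (k + rangeSum (suc k) (length xs))
    ≡⟨ solve 4 (λ d s k r → d :+ s :+ (k :+ r) := d :+ k :+ (s :+ r)) refl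
         (x ∸ k) (sum (gammaFrom (suc k) xs)) k (rangeSum (suc k) (length xs)) ⟩
  x ∸ k + k + (sum (gammaFrom (suc k) xs) + rangeSum (suc k) (length xs))
    ≡⟨ cong₂ _+_ (m∸n+n≡m k≤x) (sum-gammaFrom xs ns) ⟩
  x + sum xs ∎

take-∸ : ∀ {k x g} → k < x → DescSubset (x ∸ suc k) g → DescSubset (x ∸ k) (x ∸ k ∷ g)
take-∸ {g = g} k<x d = subst (λ j → DescSubset j (j ∷ g)) (sym (+-∸-assoc 1 k<x)) (take d)

gammaFrom-DescSubset : ∀ {k x} xs → Decreasing (x ∷ xs) → NoSpecialFrom (suc k) (x ∷ xs) →
  DescSubset (x ∸ k) (gammaFrom k (x ∷ xs))
gammaFrom-DescSubset []       [ _ ]       (k<x , _)  = take-∸ k<x (DescSubset-weaken (≤⇒≤′ z≤n) [])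
gammaFrom-DescSubset {k} (y ∷ xs) (y≤x ∷ d) (k<x , ns) =
  take-∸ k<x (DescSubset-weaken (≤⇒≤′ (∸-monoˡ-≤ (suc k) y≤x)) (gammaFrom-DescSubset xs d ns))

corollary3p2 : (n : ℕ) (a : List ℕ) → OneRowDPP n a → NoSpecialPart a
    → nonInv (perm n a) + length a * length a ≡ sum a
corollary3p2 n a@(a₁ ∷ as) (dpp _ _ a₁≤n dec _ _) ns = begin
  nonInv (perm n a) + m * m
    ≡⟨ cong (nonInv (perm n a) +_) (rangeSum-1+rangeSum-0 m) ⟨
  nonInv (complement n γ ++ γ) + (rangeSum 1 m + rangeSum 0 m)
    ≡⟨ +-assoc (nonInv (complement n γ ++ γ)) (rangeSum 1 m) (rangeSum 0 m) ⟨
  nonInv (complement n γ ++ γ) + rangeSum 1 m + rangeSum 0 m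
    ≡⟨ cong (λ l → nonInv (complement n γ ++ γ) + rangeSum 1 l + rangeSum 0 m) (length-gammaFrom 0 a) ⟨
  nonInv (complement n γ ++ γ) + rangeSum 1 (length γ) + rangeSum 0 m
    ≡⟨ cong (_+ rangeSum 0 m) (nonInv-complement γ⊆[1,n]) ⟩
  sum γ + rangeSum 0 m
    ≡⟨ sum-gammaFrom a (NoSpecialFrom-weaken a ns) ⟩
  sum a ∎
  where
  m : ℕ
  m = length a
  γ : List ℕ
  γ = gamma a
  γ⊆[1,n] : DescSubset n γ
  γ⊆[1,n] = DescSubset-weaken (≤⇒≤′ a₁≤n) (gammaFrom-DescSubset as dec ns)
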